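{- For every prime $m\geq 5$ and every $G\in\{\Gamma(\mathbb{Z}_4),\Gamma(\mathbb{Z}_6),\Gamma(\mathbb{Z}_9),\overline{\Gamma(\mathbb{Z}_6)},\overline{\Gamma(\mathbb{Z}_9)}\}$, the join graph $\Gamma(\mathbb{Z}_{3m})+G$ does not admit a distance antimagic labeling.
   Context: For an integer $n \geq 2$, the zero-divisor graph $\Gamma(\mathbb{Z}_n)$ is the simple graph whose vertex set is the set of nonzero zero-divisors of the ring $\mathbb{Z}_n$, two distinct vertices $u,v$ being adjacent iff $uv \equiv 0 \pmod n$. $\overline{H}$ denotes the complement of a graph $H$. For graphs $G,H$, the join $G+H$ is the graph obtained from the disjoint union of $G$ and $H$ by adding every edge between a vertex of $G$ and a vertex of $H$. A distance antimagic labeling (DAML) of a graph $G$ with $N$ vertices is a bijection $f:V(G)\to\{1,\dots,N\}$ such that the weights $w(v)=\sum_{u\in N(v)} f(u)$, where $N(v)$ is the open neighbourhood of $v$, are pairwise distinct over all vertices $v$. A graph admits DAML if such a labeling exists. -}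

module Defs where

open import Data.Bool using (Bool; true; false; _∧_; not; if_then_else_)
open import Data.Nat using (ℕ; zero; suc; _*_)
open import Data.Nat.Divisibility using (_∣?_)
open import Data.Fin as Fin using (Fin; toℕ; splitAt)
open import Data.List using (List; length; lookup; filterᵇ; upTo; map; allFin)
open import Data.Bool.ListAction using (any)
open import Data.Nat.ListAction using (sum)
open import Data.Sum using (inj₁; inj₂)
open import Data.Product using (Σ; _×_)
open import Function.Definitions using (Bijective; Injective)
open import Relation.Binary.PropositionalEquality using (_≡_)
open import Relation.Nullary using (does)

record Graph : Set where
  field
    order : ℕ
    adj   : Fin order → Fin order → Bool
open Graph public

nonzeroᵇ : ℕ → Bool
nonzeroᵇ zero    = false
nonzeroᵇ (suc _) = true

isZeroDivisorᵇ : ℕ → ℕ → Bool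
isZeroDivisorᵇ n x =
  nonzeroᵇ x ∧ any (λ y → nonzeroᵇ y ∧ does (n ∣? (x * y))) (upTo n)

zeroDivisors : ℕ → List ℕ
zeroDivisors n = filterᵇ (isZeroDivisorᵇ n) (upTo n)

Γℤ : ℕ → Graph
Γℤ n = record
  { order = length (zeroDivisors n)
  ; adj   = λ i j → not (does (i Fin.≟ j))
                    ∧ does (n ∣? (lookup (zeroDivisors n) i * lookup (zeroDivisors n) j))
  }

complement : Graph → Graph
complement G = record
  { order = order G
  ; adj   = λ i j → not (adj G i j) ∧ not (does (i Fin.≟ j))
  }

join : Graph → Graph → Graph
join G H = record
  { order = order G Data.Nat.+ order H
  ; adj   = λ i j → joinAdj (splitAt (order G) i) (splitAt (order G) j)
  }
  where
  open import Data.Sum using (_⊎_)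
  joinAdj : Fin (order G) ⊎ Fin (order H) → Fin (order G) ⊎ Fin (order H) → Bool
  joinAdj (inj₁ a) (inj₁ b) = adj G a b
  joinAdj (inj₂ a) (inj₂ b) = adj H a b
  joinAdj (inj₁ _) (inj₂ _) = true
  joinAdj (inj₂ _) (inj₁ _) = true

-- Weight of v under labeling f : V → Fin N, label of u being toℕ (f u) + 1
-- (so labels range over {1,…,N}); sum over the open neighbourhood of v.
weight : (G : Graph) → (Fin (order G) → Fin (order G)) → Fin (order G) → ℕ
weight G f v =
  sum (map (λ u → if adj G v u then suc (toℕ (f u)) else 0) (allFin (order G)))

IsDAML : (G : Graph) → (Fin (order G) → Fin (order G)) → Set
IsDAML G f = Bijective _≡_ _≡_ f × Injective _≡_ _≡_ (weight G f)

AdmitsDAML : Graph → Set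
AdmitsDAML G = Σ (Fin (order G) → Fin (order G)) (IsDAML G)

-- In Γ(ℤ₃ₘ) with 3 ∤ m the residues m and 2m have the same neighbours: m·z and 2m·z are
-- multiples of 3m exactly when 3 ∣ z, and they are not adjacent to each other because
-- 3m ∤ 2m². Twins stay twins in any join G + H, and two twins receive equal weights under
-- every labeling, so no labeling is distance antimagic — whatever the second summand H is.
module Submission where

open import Defs
open import Data.Nat using (ℕ; _≤_; _*_)
open import Data.Nat.Primality using (Prime)
open import Data.List using (_∷_; [])
open import Data.List.Membership.Propositional using (_∈_)
open import Relation.Nullary using (¬_)

open import Data.Nat using (suc; _<_; s≤s; z≤n; z<s; NonZero; >-nonZero)
open import Data.Nat.Properties
open import Data.Nat.Divisibility
open import Data.Nat.Coprimality using (Coprime; coprime?; coprime-divisor)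
open import Data.Nat.Primality using (prime⇒irreducible)
open import Data.Bool using (T?; if_then_else_)
open import Data.Bool.Properties using (T-≡)
open import Data.Fin as Fin using (Fin; toℕ; _↑ˡ_; splitAt)
open import Data.Fin.Properties using (splitAt-↑ˡ; ↑ˡ-injective)
open import Data.List using (lookup; allFin)
open import Data.List.Properties using (map-cong)
open import Data.List.Membership.Propositional.Properties using (∈-filter⁺; ∈-upTo⁺)
open import Data.List.Relation.Unary.Any as Any using ()
open import Data.List.Relation.Unary.Any.Properties using (lookup-index; any⁺)
open import Data.Nat.ListAction using (sum)
open import Data.Sum using (inj₁; inj₂)
open import Data.Product using (_,_)
open import Function using (_∘_)
open import Function.Bundles using (_⇔_; mk⇔; Equivalence)
open import Relation.Nullary using (yes; no)
open import Relation.Nullary.Decidable using (does-⇔; dec-false; dec-true; toWitness)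
open import Relation.Binary.PropositionalEquality

Twins : (G : Graph) → Fin (order G) → Fin (order G) → Set
Twins G u v = ∀ w → adj G u w ≡ adj G v w

twins⇒weight-≡ : ∀ {G u v} → Twins G u v →
                 (f : Fin (order G) → Fin (order G)) → weight G f u ≡ weight G f v
twins⇒weight-≡ {G} twins f =
  cong sum (map-cong (λ w → cong (λ b → if b then suc (toℕ (f w)) else 0) (twins w))
                     (allFin (order G)))

twins⇒¬AdmitsDAML : ∀ {G u v} → Twins G u v → u ≢ v → ¬ AdmitsDAML G
twins⇒¬AdmitsDAML {G} twins u≢v (f , _ , weight-injective) =
  u≢v (weight-injective (twins⇒weight-≡ {G} twins f))

join-twinsˡ : ∀ {G u v} H → Twins G u v → Twins (join G H) (u ↑ˡ order H) (v ↑ˡ order H)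
join-twinsˡ {G} {u} {v} H twins w
  rewrite splitAt-↑ˡ (order G) u (order H) | splitAt-↑ˡ (order G) v (order H)
  with splitAt (order G) w
... | inj₁ w′ = twins w′
... | inj₂ _  = refl

∈-zeroDivisors : ∀ {n x y} → 0 < x → x < n → 0 < y → y < n → n ∣ x * y → x ∈ zeroDivisors n
∈-zeroDivisors {n} {x@(suc _)} {y@(suc _)} _ x<n _ y<n n∣xy =
  ∈-filter⁺ (T? ∘ isZeroDivisorᵇ n) (∈-upTo⁺ x<n)
    (any⁺ _ (Any.map (λ { refl → Equivalence.from T-≡ (dec-true (n ∣? (x * y)) n∣xy) })
                     (∈-upTo⁺ y<n)))

residue : ∀ n → Fin (order (Γℤ n)) → ℕ
residue n = lookup (zeroDivisors n)

vertex : ∀ {n x} → x ∈ zeroDivisors n → Fin (order (Γℤ n))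
vertex = Any.index

residue-vertex : ∀ {n x} (px : x ∈ zeroDivisors n) → residue n (vertex {n} px) ≡ x
residue-vertex px = sym (lookup-index px)

Γℤ-twins : ∀ {n} (u v : Fin (order (Γℤ n))) →
           (∀ z → n ∣ residue n u * z ⇔ n ∣ residue n v * z) → ¬ n ∣ residue n u * residue n v →
           Twins (Γℤ n) u v
Γℤ-twins {n} u v same-multiples n∤uv w with u Fin.≟ w | v Fin.≟ w
... | yes _    | yes _    = refl
... | yes refl | no _     = sym (dec-false (n ∣? _) (n∤uv ∘ subst (n ∣_) (*-comm (residue n v) _)))
... | no _     | yes refl = dec-false (n ∣? _) n∤uv
... | no _     | no _     = does-⇔ (same-multiples (residue n w)) (n ∣? _) (n ∣? _)

*-cancelˡ-∣-⇔ : ∀ k .{{_ : NonZero k}} {m n} → k * m ∣ k * n ⇔ m ∣ n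
*-cancelˡ-∣-⇔ k = mk⇔ (*-cancelˡ-∣ k) (*-monoʳ-∣ k)

coprime-∣*-⇔ : ∀ {d c z} → Coprime d c → d ∣ c * z ⇔ d ∣ z
coprime-∣*-⇔ {c = c} d⊥c = mk⇔ (coprime-divisor d⊥c) (∣n⇒∣m*n c)

prime>3⇒3∤ : ∀ {p} → Prime p → 3 < p → ¬ 3 ∣ p
prime>3⇒3∤ p-prime 3<p 3∣p with prime⇒irreducible p-prime 3∣p
... | inj₁ ()
... | inj₂ refl = <-irrefl refl 3<p

module _ {m} (1<m : 1 < m) (3∤m : ¬ 3 ∣ m) where
  open Equivalence

  0<m : 0 < m
  0<m = <-trans z<s 1<m

  instance
    m≢0 : NonZero m
    m≢0 = >-nonZero 0<m

  m<2m : m < 2 * m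
  m<2m = m<m+n m (≤-trans 0<m (m≤m+n m 0))

  m<3m : m < 3 * m
  m<3m = m<m+n m (<-trans 0<m m<2m)

  2m<3m : 2 * m < 3 * m
  2m<3m = m<n+m (2 * m) 0<m

  3m∣m*z⇔3∣z : ∀ z → 3 * m ∣ m * z ⇔ 3 ∣ z
  3m∣m*z⇔3∣z z = subst (λ k → k ∣ m * z ⇔ 3 ∣ z) (*-comm m 3) (*-cancelˡ-∣-⇔ m)

  3m∣2m*z⇔3∣z : ∀ z → 3 * m ∣ 2 * m * z ⇔ 3 ∣ z
  3m∣2m*z⇔3∣z z = mk⇔
    (to 3∣2z⇔3∣z ∘ to (3m∣m*z⇔3∣z (2 * z)) ∘ subst (3 * m ∣_) 2m*z≡m*2z)
    (subst (3 * m ∣_) (sym 2m*z≡m*2z) ∘ from (3m∣m*z⇔3∣z (2 * z)) ∘ from 3∣2z⇔3∣z)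
    where
    2m*z≡m*2z : 2 * m * z ≡ m * (2 * z)
    2m*z≡m*2z = trans (cong (_* z) (*-comm 2 m)) (*-assoc m 2 z)
    3∣2z⇔3∣z : 3 ∣ 2 * z ⇔ 3 ∣ z
    3∣2z⇔3∣z = coprime-∣*-⇔ (toWitness {a? = coprime? 3 2} _)

  m∈zeroDivisors : m ∈ zeroDivisors (3 * m)
  m∈zeroDivisors = ∈-zeroDivisors 0<m m<3m z<s (*-monoʳ-< 3 1<m)
                     (subst (3 * m ∣_) (*-comm 3 m) ∣-refl)

  2m∈zeroDivisors : 2 * m ∈ zeroDivisors (3 * m)
  2m∈zeroDivisors = ∈-zeroDivisors (<-trans 0<m m<2m) 2m<3m z<s (*-monoʳ-< 3 1<m)
                      (subst (3 * m ∣_) 2*3m≡2m*3 (n∣m*n 2))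
    where
    2*3m≡2m*3 : 2 * (3 * m) ≡ 2 * m * 3
    2*3m≡2m*3 = trans (cong (2 *_) (*-comm 3 m)) (sym (*-assoc 2 m 3))

  vₘ v₂ₘ : Fin (order (Γℤ (3 * m)))
  vₘ  = vertex {3 * m} m∈zeroDivisors
  v₂ₘ = vertex {3 * m} 2m∈zeroDivisors

  residue-vₘ : residue (3 * m) vₘ ≡ m
  residue-vₘ = residue-vertex {3 * m} m∈zeroDivisors

  residue-v₂ₘ : residue (3 * m) v₂ₘ ≡ 2 * m
  residue-v₂ₘ = residue-vertex {3 * m} 2m∈zeroDivisors

  Γℤ3m-twins : Twins (Γℤ (3 * m)) vₘ v₂ₘ
  Γℤ3m-twins = Γℤ-twins vₘ v₂ₘ same-multiples 3m∤2m²
    where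
    same-multiples : ∀ z → 3 * m ∣ residue (3 * m) vₘ * z
                         ⇔ 3 * m ∣ residue (3 * m) v₂ₘ * z
    same-multiples z rewrite residue-vₘ | residue-v₂ₘ = mk⇔
      (from (3m∣2m*z⇔3∣z z) ∘ to (3m∣m*z⇔3∣z z))
      (from (3m∣m*z⇔3∣z z) ∘ to (3m∣2m*z⇔3∣z z))

    3m∤2m² : ¬ 3 * m ∣ residue (3 * m) vₘ * residue (3 * m) v₂ₘ
    3m∤2m² rewrite residue-vₘ | residue-v₂ₘ = 3∤m ∘ to (3m∣2m*z⇔3∣z m) ∘ subst (3 * m ∣_) m*2m≡2m*m
      where
      m*2m≡2m*m : m * (2 * m) ≡ 2 * m * m
      m*2m≡2m*m = trans (sym (*-assoc m 2 m)) (cong (_* m) (*-comm m 2))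

  join-Γℤ3m-¬AdmitsDAML : ∀ H → ¬ AdmitsDAML (join (Γℤ (3 * m)) H)
  join-Γℤ3m-¬AdmitsDAML H =
    twins⇒¬AdmitsDAML (join-twinsˡ H Γℤ3m-twins)
      (<⇒≢ m<2m ∘ same-residue ∘ ↑ˡ-injective (order H) vₘ v₂ₘ)
    where
    same-residue : vₘ ≡ v₂ₘ → m ≡ 2 * m
    same-residue eq = trans (sym residue-vₘ) (trans (cong (residue (3 * m)) eq) residue-v₂ₘ)

theorem2p3 : (m : ℕ) → Prime m → 5 ≤ m →
    (G : Graph) →
    G ∈ (Γℤ 4 ∷ Γℤ 6 ∷ Γℤ 9 ∷ complement (Γℤ 6) ∷ complement (Γℤ 9) ∷ []) →
    ¬ AdmitsDAML (join (Γℤ (3 * m)) G)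
theorem2p3 m m-prime 5≤m G _ =
  join-Γℤ3m-¬AdmitsDAML (≤-trans (s≤s (s≤s z≤n)) 5≤m) (prime>3⇒3∤ m-prime 3<m) G
  where
  3<m : 3 < m
  3<m = ≤-trans (n≤1+n 4) 5≤m
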